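{- Let $n\ge 1$, let $M$ be a Boolean $n\times n$ matrix and $u,v\in\{0,1\}^n$, and let $G$ be the graph constructed below, with $N=4n^2+8n+2$ nodes. Let $C$ be a maximum cardinality matching of $G$. If $uMv=1$ then $|C|=N/2$, and otherwise $|C|=N/2-1$.
   Context: $uMv$ denotes the Boolean product $\bigvee_{i,j} (u_i\wedge M_{ij}\wedge v_j)$. The graph $G$ is built as follows. Left side: nodes $L_1[i]$ ($1\le i\le n$) and $L_2[i]$ ($0\le i\le n$) forming the path $L_2[0],L_1[1],L_2[1],L_1[2],L_2[2],\dots,L_1[n],L_2[n]$; and for each $1\le i\le n$ nodes $L_3[i,j],L_4[i,j]$ ($0\le j\le n$) forming the path $L_3[i,0],L_4[i,0],L_3[i,1],L_4[i,1],\dots,L_3[i,n],L_4[i,n]$. Right side: a disjoint copy with nodes $R_1[i],R_2[i],R_3[i,j],R_4[i,j]$ and the same paths. Additional edges: $(L_4[i,j],R_4[j,i])$ for all $1\le i,j\le n$ with $M_{ij}=1$; $(L_2[i],L_3[i,0])$ for all $1\le i\le n$ with $u_i=1$; $(R_2[j],R_3[j,0])$ for all $1\le j\le n$ with $v_j=1$. -}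

module Defs where

open import Data.Nat using (ℕ; zero; suc; _+_; _*_)
open import Data.Fin using (Fin; zero; suc; inject₁)
open import Data.Bool using (Bool; true; false; _∧_; _∨_)
open import Data.List using (List; []; _∷_; concatMap; allFin; length)
open import Data.Bool.ListAction using (any)
open import Data.List.Relation.Unary.Unique.Propositional using (Unique)
open import Data.Product using (_×_; _,_; Σ)
open import Data.Sum using (_⊎_)
open import Relation.Binary.PropositionalEquality using (_≡_)

BMat : ℕ → Set
BMat n = Fin n → Fin n → Bool

BVec : ℕ → Set
BVec n = Fin n → Bool

bprod : ∀ {n} → BVec n → BMat n → BVec n → Bool
bprod {n} u M v = any (λ i → any (λ j → u i ∧ M i j ∧ v j) (allFin n)) (allFin n)

data Side : Set where
  L R : Side

-- Convention: an index i ∈ {1..n} is encoded by k : Fin n with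
-- i = k+1; an index j ∈ {0..n} is encoded by Fin (suc n) with j = toℕ.
--   node1 s k     = S_1[k+1]
--   node2 s j     = S_2[j]
--   node3 s k j   = S_3[k+1, j]
--   node4 s k j   = S_4[k+1, j]
data Node (n : ℕ) : Set where
  node1 : Side → Fin n → Node n
  node2 : Side → Fin (suc n) → Node n
  node3 : Side → Fin n → Fin (suc n) → Node n
  node4 : Side → Fin n → Fin (suc n) → Node n

data Adj {n : ℕ} (M : BMat n) (u v : BVec n) : Node n → Node n → Set where
  -- path S_2[0], S_1[1], S_2[1], ..., S_1[n], S_2[n]
  path12 : ∀ s (k : Fin n) → Adj M u v (node2 s (inject₁ k)) (node1 s k)
  path21 : ∀ s (k : Fin n) → Adj M u v (node1 s k) (node2 s (suc k))
  -- path S_3[i,0], S_4[i,0], S_3[i,1], ..., S_3[i,n], S_4[i,n]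
  path34 : ∀ s (k : Fin n) (j : Fin (suc n)) → Adj M u v (node3 s k j) (node4 s k j)
  path43 : ∀ s (k : Fin n) (j : Fin n) → Adj M u v (node4 s k (inject₁ j)) (node3 s k (suc j))
  cross  : ∀ (i j : Fin n) → M i j ≡ true → Adj M u v (node4 L i (suc j)) (node4 R j (suc i))
  uEdge  : ∀ (i : Fin n) → u i ≡ true → Adj M u v (node2 L (suc i)) (node3 L i zero)
  vEdge  : ∀ (j : Fin n) → v j ≡ true → Adj M u v (node2 R (suc j)) (node3 R j zero)

Edge : ∀ {n} → BMat n → BVec n → BVec n → Node n → Node n → Set
Edge M u v x y = Adj M u v x y ⊎ Adj M u v y x

endpoints : ∀ {n} → List (Node n × Node n) → List (Node n)
endpoints = concatMap (λ { (x , y) → x ∷ y ∷ [] })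

data AllEdges {n : ℕ} (M : BMat n) (u v : BVec n) : List (Node n × Node n) → Set where
  []  : AllEdges M u v []
  _∷_ : ∀ {x y C} → Edge M u v x y → AllEdges M u v C → AllEdges M u v ((x , y) ∷ C)

IsMatching : ∀ {n} → BMat n → BVec n → BVec n → List (Node n × Node n) → Set
IsMatching M u v C = AllEdges M u v C × Unique (endpoints C)

IsMaximumMatching : ∀ {n} → BMat n → BVec n → BVec n → List (Node n × Node n) → Set
IsMaximumMatching M u v C =
  IsMatching M u v C × (∀ C' → IsMatching M u v C' → length C' Data.Nat.≤ length C)

numNodes : ℕ → ℕ
numNodes n = 4 * (n * n) + 8 * n + 2

module Submission where

-- A matching covers 2|C| distinct nodes among N, so |C| ≤ N/2. Matching both main paths
-- from their second node on and every row completely misses only L₂[0] and R₂[0]. If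
-- u_a M_ab v_b = 1, the two main paths can be rerouted into row a on the left and row b on
-- the right, and these rows joined by the edge (L₄[a,b], R₄[b,a]): a perfect matching.
-- Conversely, in a perfect matching L₂[0] must take L₁[1], and each step forces the next,
-- so the left main path is left at some L₂[a] through L₃[a,0] (u_a = 1); this forces left
-- row a to be left through a cross edge to some R₄[b,a] (M_ab = 1), and then right row b is
-- forced down to R₃[b,0], which can only be matched to R₂[b] (v_b = 1). The explicit
-- matchings are certified by counting: a list of at most N nodes that contains every node
-- has no repetitions.

open import Defs
open import Data.Bool using (true; false; T; _∧_)
open import Data.Bool.Properties using (T-≡)
open import Data.Empty using (⊥; ⊥-elim)
open import Data.Fin using (Fin; zero; suc; inject₁; fromℕ)
open import Data.Fin.Induction using (<-weakInduction)
open import Data.Fin.Properties using (suc-injective; inject₁-injective; fromℕ≢inject₁)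
  renaming (_≟_ to _≟ᶠ_)
open import Data.List
  using (List; []; _∷_; _++_; map; concat; concatMap; allFin; length; cartesianProduct; cartesianProductWith)
open import Data.List.Properties using (length-++; length-map; length-tabulate; length-removeAt′)
open import Data.List.Membership.Propositional using (_∈_; _∉_; lose)
open import Data.List.Membership.Propositional.Properties
  using ( ∈-map⁺; ∈-++⁺ˡ; ∈-++⁺ʳ; ∈-concat⁺′; ∈-allFin
        ; ∈-cartesianProductWith⁺; ∈-cartesianProductWith⁻; ∈-cartesianProduct⁺)
open import Data.List.Relation.Binary.Subset.Propositional using (_⊆_)
open import Data.List.Relation.Binary.Disjoint.Propositional using (Disjoint)
open import Data.List.Relation.Unary.All as All using (All; []; _∷_)
import Data.List.Relation.Unary.All.Properties as Allₚ
open import Data.List.Relation.Unary.AllPairs using ([]; _∷_)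
open import Data.List.Relation.Unary.Any using (here; there; index; _─_; satisfied)
open import Data.List.Relation.Unary.Any.Properties using (any⁺; any⁻)
open import Data.List.Relation.Unary.Unique.Propositional using (Unique)
import Data.List.Relation.Unary.Unique.Propositional.Properties as Unique
open import Data.Nat using (ℕ; zero; suc; _+_; _*_; _≤_; _∸_; z≤n; s≤s; s≤s⁻¹)
open import Data.Nat.DivMod using (_/_; m*n/n≡m)
open import Data.Nat.ListAction using (sum)
open import Data.Nat.Properties
  using (≤-reflexive; ≤-antisym; ≤∧≢⇒<; <⇒≱; *-cancelˡ-≤; *-suc; *-comm)
open import Data.Nat.Tactic.RingSolver using (solve-∀)
open import Data.Product using (∃; ∃₂; _×_; _,_; proj₁; proj₂; uncurry)
open import Data.Sum using (_⊎_; inj₁; inj₂; [_,_]; [_,_]′)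
import Data.Sum as Sum
open import Function using (_∘_; id; Equivalence)
open import Relation.Nullary using (¬_; yes; no; contradiction)
open import Relation.Binary.PropositionalEquality
  using (_≡_; _≢_; refl; sym; trans; cong; cong₂; subst; subst₂; module ≡-Reasoning)

open ≡-Reasoning

module _ {A : Set} where

  private variable
    x z : A
    xs ys : List A

  ∈-─⁻ : (p : x ∈ ys) → z ∈ (ys ─ p) → z ∈ ys
  ∈-─⁻ (here _)  q         = there q
  ∈-─⁻ (there _) (here e)  = here e
  ∈-─⁻ (there p) (there q) = there (∈-─⁻ p q)

  ∈-─-split : (p : x ∈ ys) → z ∈ ys → z ≡ x ⊎ z ∈ (ys ─ p)
  ∈-─-split (here x≡y) (here z≡y) = inj₁ (trans z≡y (sym x≡y))
  ∈-─-split (here _)   (there q)  = inj₂ q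
  ∈-─-split (there _)  (here z≡y) = inj₂ (here z≡y)
  ∈-─-split (there p)  (there q)  = Sum.map₂ there (∈-─-split p q)

  length-─ : (p : x ∈ ys) → length ys ≡ suc (length (ys ─ p))
  length-─ {ys = ys} p = length-removeAt′ ys (index p)

  Unique-─ : (p : x ∈ ys) → Unique ys → Unique (ys ─ p)
  Unique-─ (here _)  (_ ∷ u)    = u
  Unique-─ (there p) (y∉ys ∷ u) = All.tabulate (All.lookup y∉ys ∘ ∈-─⁻ p) ∷ Unique-─ p u

  All≢⇒≢ : All (x ≢_) xs → z ∈ xs → z ≢ x
  All≢⇒≢ x∉xs z∈xs = All.lookup x∉xs z∈xs ∘ sym

  ∈-─⇒≢ : (p : x ∈ ys) → Unique ys → z ∈ (ys ─ p) → z ≢ x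
  ∈-─⇒≢ (here refl) (x∉ys ∷ _) q           = All≢⇒≢ x∉ys q
  ∈-─⇒≢ (there p)   (y∉ys ∷ _) (here refl) = All.lookup y∉ys p
  ∈-─⇒≢ (there p)   (_ ∷ u)    (there q)   = ∈-─⇒≢ p u q

  ⊆-─ : (p : x ∈ ys) → (∀ {z} → z ∈ xs → z ≢ x) → xs ⊆ ys → xs ⊆ (ys ─ p)
  ⊆-─ p ≢x xs⊆ys q = [ ⊥-elim ∘ ≢x q , id ] (∈-─-split p (xs⊆ys q))

  ∈-∷⇒∈ : z ∈ x ∷ xs → z ≢ x → z ∈ xs
  ∈-∷⇒∈ (here z≡x) z≢x = contradiction z≡x z≢x
  ∈-∷⇒∈ (there q)  _   = q

  Unique⇒length≤ : Unique xs → xs ⊆ ys → length xs ≤ length ys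
  Unique⇒length≤ [] _ = z≤n
  Unique⇒length≤ {xs = x ∷ xs} {ys = ys} (x∉xs ∷ u) xs⊆ys =
    subst (suc (length xs) ≤_) (sym (length-─ p))
      (s≤s (Unique⇒length≤ u (⊆-─ p (All≢⇒≢ x∉xs) (λ q → xs⊆ys (there q)))))
    where p = xs⊆ys (here refl)

  length≤⇒Unique : Unique ys → ys ⊆ xs → xs ⊆ ys → length xs ≤ length ys → Unique xs
  length≤⇒Unique {xs = []} _ _ _ _ = []
  length≤⇒Unique {ys = ys} {xs = x ∷ xs} uys ys⊆ xs⊆ ∣xs∣<∣ys∣ =
    Allₚ.¬Any⇒All¬ xs x∉xs ∷
    length≤⇒Unique (Unique-─ p uys) ys─p⊆xs xs⊆ys─p ∣xs∣≤∣ys─p∣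
    where
    p = xs⊆ (here refl)
    x∉xs : x ∉ xs
    x∉xs x∈xs = <⇒≱ ∣xs∣<∣ys∣ (Unique⇒length≤ uys λ q → absorb (ys⊆ q))
      where
      absorb : ∀ {z} → z ∈ x ∷ xs → z ∈ xs
      absorb (here refl)  = x∈xs
      absorb (there z∈xs) = z∈xs
    ys─p⊆xs : (ys ─ p) ⊆ xs
    ys─p⊆xs q = ∈-∷⇒∈ (ys⊆ (∈-─⁻ p q)) (∈-─⇒≢ p uys q)
    xs⊆ys─p : xs ⊆ (ys ─ p)
    xs⊆ys─p = ⊆-─ p (λ q x≡z → x∉xs (subst (_∈ xs) x≡z q)) (λ q → xs⊆ (there q))
    ∣xs∣≤∣ys─p∣ : length xs ≤ length (ys ─ p)
    ∣xs∣≤∣ys─p∣ = s≤s⁻¹ (subst (suc (length xs) ≤_) (length-─ p) ∣xs∣<∣ys∣)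

  length≤⇒⊇ : Unique xs → xs ⊆ ys → length ys ≤ length xs → ys ⊆ xs
  length≤⇒⊇ {ys = []} _ _ _ ()
  length≤⇒⊇ {xs = []} {ys = _ ∷ _} _ _ ()
  length≤⇒⊇ {xs = x ∷ xs} {ys = ys} (x∉xs ∷ u) xs⊆ ∣ys∣≤ q =
    [ (λ { refl → here refl }) , there ∘ ys─p⊆xs ] (∈-─-split p q)
    where
    p = xs⊆ (here refl)
    ys─p⊆xs : (ys ─ p) ⊆ xs
    ys─p⊆xs = length≤⇒⊇ u (⊆-─ p (All≢⇒≢ x∉xs) (λ r → xs⊆ (there r)))
                (s≤s⁻¹ (subst (_≤ suc (length xs)) (length-─ p) ∣ys∣≤))

module _ {A B : Set} where

  ⊆-concatMap : ∀ {f : A → List B} {a as} → a ∈ as → f a ⊆ concatMap f as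
  ⊆-concatMap {f} a∈as q = ∈-concat⁺′ q (∈-map⁺ f a∈as)

  All-concatMap : ∀ {P : B → Set} {f : A → List B} → (∀ a → All P (f a)) →
    ∀ as → All P (concatMap f as)
  All-concatMap h as = Allₚ.concat⁺ (Allₚ.map⁺ (All.tabulate {xs = as} λ {a} _ → h a))

  length-concatMap : ∀ (f : A → List B) {c} → (∀ a → length (f a) ≡ c) →
    ∀ as → length (concatMap f as) ≡ length as * c
  length-concatMap f h []       = refl
  length-concatMap f h (a ∷ as) = trans (length-++ (f a)) (cong₂ _+_ (h a) (length-concatMap f h as))

  length-cartesianProductWith : ∀ {C : Set} (f : A → B → C) xs ys →
    length (cartesianProductWith f xs ys) ≡ length xs * length ys
  length-cartesianProductWith f []       ys = refl
  length-cartesianProductWith f (x ∷ xs) ys =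
    trans (length-++ (map (f x) ys)) (cong₂ _+_ (length-map (f x) ys) (length-cartesianProductWith f xs ys))

length-concat : ∀ {A : Set} (xss : List (List A)) → length (concat xss) ≡ sum (map length xss)
length-concat []         = refl
length-concat (xs ∷ xss) = trans (length-++ xs) (cong (length xs +_) (length-concat xss))

length-allFin : ∀ m → length (allFin m) ≡ m
length-allFin m = length-tabulate id

inject₁≢suc : ∀ {m} (k : Fin m) → inject₁ k ≢ suc k
inject₁≢suc zero    ()
inject₁≢suc (suc k) eq = inject₁≢suc k (suc-injective eq)

module _ {A : Set} where

  Matched : List (A × A) → A → A → Set
  Matched C x y = (x , y) ∈ C ⊎ (y , x) ∈ C

  Covered : List (A × A) → A → Set
  Covered C x = ∃ (Matched C x)

  Matched-sym : ∀ {C x y} → Matched C x y → Matched C y x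
  Matched-sym = Sum.swap

  Covered-mono : ∀ {C D x} → C ⊆ D → Covered C x → Covered D x
  Covered-mono C⊆D (y , m) = y , Sum.map C⊆D C⊆D m

  -- The matching of the path X₀ Y₀ X₁ Y₁ … Y_{m-1} X_m that covers every node except X j.
  matchingAvoiding : ∀ {m} → (Fin (suc m) → A) → (Fin m → A) → Fin (suc m) → List (A × A)
  matchingAvoiding X Y zero = map (λ k → Y k , X (suc k)) (allFin _)
  matchingAvoiding {suc m} X Y (suc j) = (X zero , Y zero) ∷ matchingAvoiding (X ∘ suc) (Y ∘ suc) j

  length-matchingAvoiding : ∀ {m} X Y (j : Fin (suc m)) → length (matchingAvoiding X Y j) ≡ m
  length-matchingAvoiding {m} X Y zero = trans (length-map _ (allFin m)) (length-allFin m)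
  length-matchingAvoiding {suc m} X Y (suc j) = cong suc (length-matchingAvoiding (X ∘ suc) (Y ∘ suc) j)

  matchingAvoiding-All : ∀ {m} X Y (E : A → A → Set) →
    (∀ k → E (X (inject₁ k)) (Y k)) → (∀ k → E (Y k) (X (suc k))) →
    (j : Fin (suc m)) → All (uncurry E) (matchingAvoiding X Y j)
  matchingAvoiding-All X Y E forward backward zero = Allₚ.map⁺ (Allₚ.tabulate⁺ backward)
  matchingAvoiding-All {suc m} X Y E forward backward (suc j) =
    forward zero ∷ matchingAvoiding-All (X ∘ suc) (Y ∘ suc) E (forward ∘ suc) (backward ∘ suc) j

  matchingAvoiding-coversʸ : ∀ {m} X Y (j : Fin (suc m)) k → Covered (matchingAvoiding X Y j) (Y k)
  matchingAvoiding-coversʸ X Y zero    k      = X (suc k) , inj₁ (∈-map⁺ _ (∈-allFin k))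
  matchingAvoiding-coversʸ {suc m} X Y (suc j) zero    = X zero , inj₂ (here refl)
  matchingAvoiding-coversʸ {suc m} X Y (suc j) (suc k) =
    Covered-mono there (matchingAvoiding-coversʸ (X ∘ suc) (Y ∘ suc) j k)

  matchingAvoiding-coversˣ : ∀ {m} X Y (j : Fin (suc m)) i → i ≢ j → Covered (matchingAvoiding X Y j) (X i)
  matchingAvoiding-coversˣ X Y zero zero    i≢j = contradiction refl i≢j
  matchingAvoiding-coversˣ X Y zero (suc k) _   = Y k , inj₂ (∈-map⁺ _ (∈-allFin k))
  matchingAvoiding-coversˣ {suc m} X Y (suc j) zero    _   = Y zero , inj₁ (here refl)
  matchingAvoiding-coversˣ {suc m} X Y (suc j) (suc i) i≢j =
    Covered-mono there (matchingAvoiding-coversˣ (X ∘ suc) (Y ∘ suc) j i (i≢j ∘ cong suc))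

module Walks {A : Set} (P : A → A → Set)
  (P-sym : ∀ {x y} → P x y → P y x)
  (P-functional : ∀ {x y z} → P x y → P x z → y ≡ z)
  (partner : ∀ x → ∃ (P x)) where

  private
    distinct : ∀ {m} {X : Fin (suc m) → A} → (∀ {i j} → X i ≡ X j → i ≡ j) →
      ∀ {k y} → P (X (inject₁ k)) y → P (X (suc k)) y → ⊥
    distinct X-injective {k} p q = inject₁≢suc k (X-injective (P-functional (P-sym p) (P-sym q)))

  -- On the path X₀ Y₀ X₁ … Y_{m-1} X_m, X₀ cannot be matched backwards, and an X_j matched
  -- forwards to Y_j leaves X_{j+1} no backward partner; so some X_j takes an exit edge.
  forwardWalk : ∀ {m} (X : Fin (suc m) → A) (Y : Fin m → A) {Exit : Fin (suc m) → A → Set} →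
    (∀ {i j} → X i ≡ X j → i ≡ j) →
    (∀ {j z} → P (X j) z →
       Exit j z ⊎ (∃ λ k → j ≡ inject₁ k × z ≡ Y k) ⊎ (∃ λ k → j ≡ suc k × z ≡ Y k)) →
    ∃₂ λ j z → P (X j) z × Exit j z
  forwardWalk {m} X Y {Exit} X-injective neighbours =
    exit (<-weakInduction ExitOrForward start step (fromℕ m))
    where
    Found = ∃₂ λ j z → P (X j) z × Exit j z
    ExitOrForward : Fin (suc m) → Set
    ExitOrForward j = Found ⊎ ¬ (∃ λ k → j ≡ suc k × P (X j) (Y k))

    start : ExitOrForward zero
    start = inj₂ λ { (_ , () , _) }

    step : ∀ k → ExitOrForward (inject₁ k) → ExitOrForward (suc k)
    step k (inj₁ found) = inj₁ found
    step k (inj₂ notBackward) with z , p ← partner (X (inject₁ k)) | neighbours p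
    ... | inj₁ e = inj₁ (_ , z , p , e)
    ... | inj₂ (inj₁ (k′ , eq , refl)) with refl ← inject₁-injective eq =
      inj₂ λ { (_ , refl , q) → distinct X-injective p q }
    ... | inj₂ (inj₂ (k′ , eq , refl)) = contradiction (k′ , eq , p) notBackward

    exit : ExitOrForward (fromℕ m) → Found
    exit (inj₁ found) = found
    exit (inj₂ notBackward) with z , p ← partner (X (fromℕ m)) | neighbours p
    ... | inj₁ e = _ , z , p , e
    ... | inj₂ (inj₁ (_ , eq , _)) = contradiction eq fromℕ≢inject₁
    ... | inj₂ (inj₂ (k , eq , refl)) = contradiction (k , eq , p) notBackward

  -- On the path X₀ Z₀ X₁ Z₁ … X_m Z_m, an X_j not matched to Z_j is matched to Z_{j-1} or
  -- exits; in the former case X_{j-1} is not matched to Z_{j-1}.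
  backwardWalk : ∀ {m} (X Z : Fin (suc m) → A) {Exit : Fin (suc m) → A → Set} →
    (∀ {i j} → X i ≡ X j → i ≡ j) →
    (∀ {j z} → P (X j) z → Exit j z ⊎ z ≡ Z j ⊎ (∃ λ k → j ≡ suc k × z ≡ Z (inject₁ k))) →
    ∀ j → ¬ P (X j) (Z j) → ∃₂ λ j z → P (X j) z × Exit j z
  backwardWalk X Z X-injective neighbours = <-weakInduction _ start step
    where
    start : ¬ P (X zero) (Z zero) → _
    start notForward with z , p ← partner (X zero) | neighbours p
    ... | inj₁ e = zero , z , p , e
    ... | inj₂ (inj₁ refl) = contradiction p notForward
    ... | inj₂ (inj₂ (_ , () , _))

    step : ∀ k → (¬ P (X (inject₁ k)) (Z (inject₁ k)) → _) → ¬ P (X (suc k)) (Z (suc k)) → _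
    step k walkOn notForward with z , p ← partner (X (suc k)) | neighbours p
    ... | inj₁ e = suc k , z , p , e
    ... | inj₂ (inj₁ refl) = contradiction p notForward
    ... | inj₂ (inj₂ (_ , refl , refl)) = walkOn λ q → distinct X-injective q p

private
  Pairs : ℕ → Set
  Pairs n = List (Node n × Node n)

sides : List Side
sides = L ∷ R ∷ []

∈-sides : ∀ s → s ∈ sides
∈-sides L = here refl
∈-sides R = there (here refl)

sideOf : ∀ {n} → Node n → Side
sideOf (node1 s _)   = s
sideOf (node2 s _)   = s
sideOf (node3 s _ _) = s
sideOf (node4 s _ _) = s

module _ {n : ℕ} where

  Matched⇒∈endpoints : ∀ {C : Pairs n} {x y} → Matched C x y → x ∈ endpoints C
  Matched⇒∈endpoints {_ ∷ _} (inj₁ (here refl)) = here refl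
  Matched⇒∈endpoints {_ ∷ _} (inj₂ (here refl)) = there (here refl)
  Matched⇒∈endpoints {(_ , _) ∷ _} (inj₁ (there p)) = there (there (Matched⇒∈endpoints (inj₁ p)))
  Matched⇒∈endpoints {(_ , _) ∷ _} (inj₂ (there p)) = there (there (Matched⇒∈endpoints (inj₂ p)))

  Covered⇒∈endpoints : ∀ {C : Pairs n} {x} → Covered C x → x ∈ endpoints C
  Covered⇒∈endpoints (_ , m) = Matched⇒∈endpoints m

  ∈endpoints⇒Covered : ∀ {C : Pairs n} {x} → x ∈ endpoints C → Covered C x
  ∈endpoints⇒Covered {(_ , b) ∷ _} (here refl)         = b , inj₁ (here refl)
  ∈endpoints⇒Covered {(a , _) ∷ _} (there (here refl)) = a , inj₂ (here refl)
  ∈endpoints⇒Covered {(_ , _) ∷ _} (there (there q))   = Covered-mono there (∈endpoints⇒Covered q)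

  length-endpoints : ∀ (C : Pairs n) → length (endpoints C) ≡ 2 * length C
  length-endpoints []            = refl
  length-endpoints ((_ , _) ∷ C) = trans (cong (2 +_) (length-endpoints C)) (sym (*-suc 2 (length C)))

  private
    Matched-∷ : ∀ {a b} {C : Pairs n} {x y} → Matched ((a , b) ∷ C) x y →
      (x ≡ a × y ≡ b) ⊎ (x ≡ b × y ≡ a) ⊎ Matched C x y
    Matched-∷ (inj₁ (here refl)) = inj₁ (refl , refl)
    Matched-∷ (inj₂ (here refl)) = inj₂ (inj₁ (refl , refl))
    Matched-∷ (inj₁ (there p))   = inj₂ (inj₂ (inj₁ p))
    Matched-∷ (inj₂ (there p))   = inj₂ (inj₂ (inj₂ p))

    All≢⇒¬Matched : ∀ {C : Pairs n} {x y} → All (x ≢_) (endpoints C) → ¬ Matched C x y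
    All≢⇒¬Matched x∉C m = All≢⇒≢ x∉C (Matched⇒∈endpoints m) refl

  Matched-functional : ∀ {C : Pairs n} {x y z} → Unique (endpoints C) →
    Matched C x y → Matched C x z → y ≡ z
  Matched-functional {[]} _ (inj₁ ()) _
  Matched-functional {[]} _ (inj₂ ()) _
  Matched-functional {(a , b) ∷ C} (a∉ ∷ b∉ ∷ u) p q with Matched-∷ p | Matched-∷ q
  ... | inj₁ (refl , refl)        | inj₁ (_ , refl)        = refl
  ... | inj₁ (refl , refl)        | inj₂ (inj₁ (x≡b , _))  = contradiction x≡b (All.head a∉)
  ... | inj₁ (refl , refl)        | inj₂ (inj₂ q′)         = ⊥-elim (All≢⇒¬Matched (All.tail a∉) q′)
  ... | inj₂ (inj₁ (refl , refl)) | inj₁ (x≡a , _)         = contradiction (sym x≡a) (All.head a∉)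
  ... | inj₂ (inj₁ (refl , refl)) | inj₂ (inj₁ (_ , refl)) = refl
  ... | inj₂ (inj₁ (refl , refl)) | inj₂ (inj₂ q′)         = ⊥-elim (All≢⇒¬Matched b∉ q′)
  ... | inj₂ (inj₂ p′)            | inj₁ (refl , _)        = ⊥-elim (All≢⇒¬Matched (All.tail a∉) p′)
  ... | inj₂ (inj₂ p′)            | inj₂ (inj₁ (refl , _)) = ⊥-elim (All≢⇒¬Matched b∉ p′)
  ... | inj₂ (inj₂ p′)            | inj₂ (inj₂ q′)         = Matched-functional u p′ q′

module _ (n : ℕ) where

  private
    grid : List (Fin n × Fin (suc n))
    grid = cartesianProduct (allFin n) (allFin (suc n))

    node3′ node4′ : Side → Fin n × Fin (suc n) → Node n
    node3′ s = uncurry (node3 s)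
    node4′ s = uncurry (node4 s)

  nodesByConstructor : List (List (Node n))
  nodesByConstructor =
    cartesianProductWith node1 sides (allFin n) ∷
    cartesianProductWith node2 sides (allFin (suc n)) ∷
    cartesianProductWith node3′ sides grid ∷
    cartesianProductWith node4′ sides grid ∷ []

  allNodes : List (Node n)
  allNodes = concat nodesByConstructor

  private
    inBlock : ∀ {x block} → x ∈ block → block ∈ nodesByConstructor → x ∈ allNodes
    inBlock = ∈-concat⁺′ {xss = nodesByConstructor}

  ∈-allNodes : ∀ x → x ∈ allNodes
  ∈-allNodes (node1 s k) =
    inBlock (∈-cartesianProductWith⁺ node1 (∈-sides s) (∈-allFin k)) (here refl)
  ∈-allNodes (node2 s j) =
    inBlock (∈-cartesianProductWith⁺ node2 (∈-sides s) (∈-allFin j)) (there (here refl))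
  ∈-allNodes (node3 s i j) =
    inBlock (∈-cartesianProductWith⁺ node3′ (∈-sides s) (∈-cartesianProduct⁺ (∈-allFin i) (∈-allFin j)))
      (there (there (here refl)))
  ∈-allNodes (node4 s i j) =
    inBlock (∈-cartesianProductWith⁺ node4′ (∈-sides s) (∈-cartesianProduct⁺ (∈-allFin i) (∈-allFin j)))
      (there (there (there (here refl))))

  length-allNodes : length allNodes ≡ numNodes n
  length-allNodes = begin
    length allNodes
      ≡⟨ length-concat nodesByConstructor ⟩
    sum (map length nodesByConstructor)
      ≡⟨ cong₂ _+_ (size node1 (allFin n) (length-allFin n))
           (cong₂ _+_ (size node2 (allFin (suc n)) (length-allFin (suc n)))
             (cong₂ _+_ (size node3′ grid length-grid) (cong (_+ 0) (size node4′ grid length-grid)))) ⟩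
    2 * n + (2 * suc n + (2 * (n * suc n) + (2 * (n * suc n) + 0)))
      ≡⟨ count n ⟩
    numNodes n ∎
    where
    length-grid : length grid ≡ n * suc n
    length-grid = trans (length-cartesianProductWith _,_ (allFin n) (allFin (suc n)))
                        (cong₂ _*_ (length-allFin n) (length-allFin (suc n)))
    size : ∀ {B : Set} (f : Side → B → Node n) (bs : List B) {m} → length bs ≡ m →
           length (cartesianProductWith f sides bs) ≡ 2 * m
    size f bs eq = trans (length-cartesianProductWith f sides bs) (cong (2 *_) eq)
    count : ∀ n → 2 * n + (2 * suc n + (2 * (n * suc n) + (2 * (n * suc n) + 0))) ≡ 4 * (n * n) + 8 * n + 2
    count = solve-∀

  private
    constructorIndex : Node n → ℕ
    constructorIndex (node1 _ _)   = 1
    constructorIndex (node2 _ _)   = 2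
    constructorIndex (node3 _ _ _) = 3
    constructorIndex (node4 _ _ _) = 4

    OfConstructor : ℕ → List (Node n) → Set
    OfConstructor c xs = ∀ {x} → x ∈ xs → constructorIndex x ≡ c

    ofConstructor : ∀ {B C : Set} {c} (f : B → C → Node n) → (∀ b d → constructorIndex (f b d) ≡ c) →
      ∀ bs ds → OfConstructor c (cartesianProductWith f bs ds)
    ofConstructor f index-f bs ds x∈
      with b , d , _ , _ , refl ← ∈-cartesianProductWith⁻ f bs ds x∈ = index-f b d

    apart : ∀ {c d xs ys} → OfConstructor c xs → OfConstructor d ys → c ≢ d → Disjoint xs ys
    apart xs⊆c ys⊆d c≢d (x∈xs , x∈ys) = c≢d (trans (sym (xs⊆c x∈xs)) (ys⊆d x∈ys))

  Unique-allNodes : Unique allNodes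
  Unique-allNodes = Unique.concat⁺
    (unique node1 (λ { refl → refl , refl }) (Unique.allFin⁺ n) ∷
     unique node2 (λ { refl → refl , refl }) (Unique.allFin⁺ (suc n)) ∷
     unique node3′ (λ { {y = _ , _} {z = _ , _} refl → refl , refl }) unique-grid ∷
     unique node4′ (λ { {y = _ , _} {z = _ , _} refl → refl , refl }) unique-grid ∷ [])
    ((apart c₁ c₂ (λ ()) ∷ apart c₁ c₃ (λ ()) ∷ apart c₁ c₄ (λ ()) ∷ []) ∷
     (apart c₂ c₃ (λ ()) ∷ apart c₂ c₄ (λ ()) ∷ []) ∷
     (apart c₃ c₄ (λ ()) ∷ []) ∷ [] ∷ [])
    where
    unique : ∀ {B : Set} (f : Side → B → Node n) {bs} →
             (∀ {w x y z} → f w y ≡ f x z → w ≡ x × y ≡ z) → Unique bs → Unique (cartesianProductWith f sides bs)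
    unique f f-injective = Unique.cartesianProductWith⁺ f f-injective (((λ ()) ∷ []) ∷ [] ∷ [])
    unique-grid = Unique.cartesianProduct⁺ (Unique.allFin⁺ n) (Unique.allFin⁺ (suc n))
    c₁ = ofConstructor node1 (λ _ _ → refl) sides (allFin n)
    c₂ = ofConstructor node2 (λ _ _ → refl) sides (allFin (suc n))
    c₃ = ofConstructor node3′ (λ { _ (_ , _) → refl }) sides grid
    c₄ = ofConstructor node4′ (λ { _ (_ , _) → refl }) sides grid

  Unique⇒length≤numNodes : ∀ {xs} → Unique xs → length xs ≤ numNodes n
  Unique⇒length≤numNodes {xs} u =
    subst (length xs ≤_) length-allNodes (Unique⇒length≤ u (λ {x} _ → ∈-allNodes x))

  covering⇒Unique : ∀ {xs} → (∀ x → x ∈ xs) → length xs ≤ numNodes n → Unique xs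
  covering⇒Unique {xs} covering ∣xs∣≤ =
    length≤⇒Unique Unique-allNodes (λ {x} _ → covering x) (λ {x} _ → ∈-allNodes x)
      (subst (length xs ≤_) (sym length-allNodes) ∣xs∣≤)

  Unique⇒covering : ∀ {xs} → Unique xs → numNodes n ≤ length xs → ∀ x → x ∈ xs
  Unique⇒covering {xs} u N≤∣xs∣ x =
    length≤⇒⊇ u (λ {y} _ → ∈-allNodes y) (subst (_≤ length xs) (sym length-allNodes) N≤∣xs∣)
      (∈-allNodes x)

sideSize : ℕ → ℕ
sideSize n = n + n * suc n

numNodes≡ : ∀ n → numNodes n ≡ 2 * suc (2 * sideSize n)
numNodes≡ = expanded
  where
  expanded : ∀ n → 4 * (n * n) + 8 * n + 2 ≡ 2 * suc (2 * (n + n * suc n))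
  expanded = solve-∀

numNodes/2 : ∀ n → numNodes n / 2 ≡ suc (2 * sideSize n)
numNodes/2 n = trans (cong (_/ 2) (trans (numNodes≡ n) (*-comm 2 half))) (m*n/n≡m half 2)
  where half = suc (2 * sideSize n)

module _ {n : ℕ} where

  mainMatching : Side → Fin (suc n) → Pairs n
  mainMatching s = matchingAvoiding (node2 s) (node1 s)

  -- Row i is the path node3 s i zero, X₀, Y₀, …, X_n with X = node4 s i, Y = node3 s i ∘ suc;
  -- the entry pair covers node3 s i zero.
  rowMatching : Side → Fin n → Node n × Node n → Fin (suc n) → Pairs n
  rowMatching s i entry hole = entry ∷ matchingAvoiding (node4 s i) (node3 s i ∘ suc) hole

  standardRow : Side → Fin n → Pairs n
  standardRow s i = rowMatching s i (node3 s i zero , node4 s i zero) zero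

  enteredRow : Side → Fin n → Fin n → Pairs n
  enteredRow s a c = rowMatching s a (node2 s (suc a) , node3 s a zero) (suc c)

  nearPerfectSide : Side → Pairs n
  nearPerfectSide s = mainMatching s zero ++ concatMap (standardRow s) (allFin n)

  enteredSide : Side → Fin n × Fin n → Pairs n
  enteredSide s (a , c) =
    enteredRow s a c ++ mainMatching s (suc a) ++ concatMap (standardRow s) (allFin n ─ ∈-allFin a)

  nearPerfect : Pairs n
  nearPerfect = concatMap nearPerfectSide sides

  crossingEntries : Fin n → Fin n → Side → Fin n × Fin n
  crossingEntries a b L = a , b
  crossingEntries a b R = b , a

  perfectSide : Fin n → Fin n → Side → Pairs n
  perfectSide a b s = enteredSide s (crossingEntries a b s)

  perfect : Fin n → Fin n → Pairs n
  perfect a b = (node4 L a (suc b) , node4 R b (suc a)) ∷ concatMap (perfectSide a b) sides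

  length-rowMatching : ∀ s i entry hole → length (rowMatching s i entry hole) ≡ suc n
  length-rowMatching s i _ hole = cong suc (length-matchingAvoiding (node4 s i) (node3 s i ∘ suc) hole)

  length-standardRows : ∀ s is → length (concatMap (standardRow s) is) ≡ length is * suc n
  length-standardRows s =
    length-concatMap (standardRow s) (λ i → length-rowMatching s i (node3 s i zero , node4 s i zero) zero)

  length-nearPerfectSide : ∀ s → length (nearPerfectSide s) ≡ sideSize n
  length-nearPerfectSide s = begin
    length (nearPerfectSide s)
      ≡⟨ length-++ (mainMatching s zero) ⟩
    length (mainMatching s zero) + length (concatMap (standardRow s) (allFin n))
      ≡⟨ cong₂ _+_ (length-matchingAvoiding (node2 s) (node1 s) zero)
                   (trans (length-standardRows s (allFin n)) (cong (_* suc n) (length-allFin n))) ⟩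
    sideSize n ∎

  length-enteredSide : ∀ s e → length (enteredSide s e) ≡ sideSize n
  length-enteredSide s (a , c) = begin
    length (enteredSide s (a , c))
      ≡⟨ length-++ (enteredRow s a c) ⟩
    length (enteredRow s a c) + length (mainMatching s (suc a) ++ otherRows)
      ≡⟨ cong (length (enteredRow s a c) +_) (length-++ (mainMatching s (suc a))) ⟩
    length (enteredRow s a c) + (length (mainMatching s (suc a)) + length otherRows)
      ≡⟨ cong₂ _+_ (length-rowMatching s a (node2 s (suc a) , node3 s a zero) (suc c))
           (cong₂ _+_ (length-matchingAvoiding (node2 s) (node1 s) (suc a)) (length-standardRows s rest)) ⟩
    suc n + (n + length rest * suc n)
      ≡⟨ regroup (trans (sym (length-allFin n)) (length-─ (∈-allFin a))) ⟩
    sideSize n ∎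
    where
    rest = allFin n ─ ∈-allFin a
    otherRows = concatMap (standardRow s) rest
    regroup : ∀ {n r} → n ≡ suc r → suc n + (n + r * suc n) ≡ sideSize n
    regroup {r = r} refl = expanded r
      where
      expanded : ∀ r → suc (suc r) + (suc r + r * suc (suc r)) ≡ suc r + suc r * suc (suc r)
      expanded = solve-∀

  length-nearPerfect : length nearPerfect ≡ 2 * sideSize n
  length-nearPerfect = length-concatMap nearPerfectSide length-nearPerfectSide sides

  length-perfect : ∀ a b → length (perfect a b) ≡ suc (2 * sideSize n)
  length-perfect a b =
    cong suc (length-concatMap (perfectSide a b) (λ s → length-enteredSide s (crossingEntries a b s)) sides)

  rowMatching-covers₃ : ∀ s i entry hole k → Covered (rowMatching s i entry hole) (node3 s i (suc k))
  rowMatching-covers₃ s i _ hole k =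
    Covered-mono there (matchingAvoiding-coversʸ (node4 s i) (node3 s i ∘ suc) hole k)

  rowMatching-covers₄ : ∀ s i entry hole j → j ≢ hole → Covered (rowMatching s i entry hole) (node4 s i j)
  rowMatching-covers₄ s i _ hole j j≢hole =
    Covered-mono there (matchingAvoiding-coversˣ (node4 s i) (node3 s i ∘ suc) hole j j≢hole)

  standardRow-covers₃ : ∀ s i j → Covered (standardRow s i) (node3 s i j)
  standardRow-covers₃ s i zero    = node4 s i zero , inj₁ (here refl)
  standardRow-covers₃ s i (suc k) = rowMatching-covers₃ s i _ zero k

  standardRow-covers₄ : ∀ s i j → Covered (standardRow s i) (node4 s i j)
  standardRow-covers₄ s i zero    = node3 s i zero , inj₂ (here refl)
  standardRow-covers₄ s i (suc k) = rowMatching-covers₄ s i _ zero (suc k) λ ()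

  enteredRow-covers₃ : ∀ s a c j → Covered (enteredRow s a c) (node3 s a j)
  enteredRow-covers₃ s a c zero    = node2 s (suc a) , inj₂ (here refl)
  enteredRow-covers₃ s a c (suc k) = rowMatching-covers₃ s a _ (suc c) k

  private
    inRows : ∀ s i → standardRow s i ⊆ nearPerfectSide s
    inRows s i = ∈-++⁺ʳ (mainMatching s zero) ∘ ⊆-concatMap (∈-allFin i)

    inMain : ∀ s {a c} → mainMatching s (suc a) ⊆ enteredSide s (a , c)
    inMain s {a} {c} = ∈-++⁺ʳ (enteredRow s a c) ∘ ∈-++⁺ˡ

    inOtherRows : ∀ s {a c i} → i ∈ (allFin n ─ ∈-allFin a) → standardRow s i ⊆ enteredSide s (a , c)
    inOtherRows s {a} {c} i∈rest =
      ∈-++⁺ʳ (enteredRow s a c) ∘ ∈-++⁺ʳ (mainMatching s (suc a)) ∘ ⊆-concatMap i∈rest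

  nearPerfectSide-covers : ∀ x → Covered (nearPerfectSide (sideOf x)) x ⊎ x ≡ node2 (sideOf x) zero
  nearPerfectSide-covers (node1 s k) =
    inj₁ (Covered-mono ∈-++⁺ˡ (matchingAvoiding-coversʸ (node2 s) (node1 s) zero k))
  nearPerfectSide-covers (node2 s zero) = inj₂ refl
  nearPerfectSide-covers (node2 s (suc k)) =
    inj₁ (Covered-mono ∈-++⁺ˡ (matchingAvoiding-coversˣ (node2 s) (node1 s) zero (suc k) λ ()))
  nearPerfectSide-covers (node3 s i j) = inj₁ (Covered-mono (inRows s i) (standardRow-covers₃ s i j))
  nearPerfectSide-covers (node4 s i j) = inj₁ (Covered-mono (inRows s i) (standardRow-covers₄ s i j))

  enteredSide-covers : ∀ e x →
    Covered (enteredSide (sideOf x) e) x ⊎ x ≡ node4 (sideOf x) (proj₁ e) (suc (proj₂ e))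
  enteredSide-covers (a , c) (node1 s k) =
    inj₁ (Covered-mono (inMain s) (matchingAvoiding-coversʸ (node2 s) (node1 s) (suc a) k))
  enteredSide-covers (a , c) (node2 s j) with j ≟ᶠ suc a
  ... | yes refl = inj₁ (node3 s a zero , inj₁ (here refl))
  ... | no j≢1+a =
    inj₁ (Covered-mono (inMain s) (matchingAvoiding-coversˣ (node2 s) (node1 s) (suc a) j j≢1+a))
  enteredSide-covers (a , c) (node3 s i j) with ∈-─-split (∈-allFin a) (∈-allFin i)
  ... | inj₁ refl = inj₁ (Covered-mono ∈-++⁺ˡ (enteredRow-covers₃ s a c j))
  ... | inj₂ i∈rest = inj₁ (Covered-mono (inOtherRows s i∈rest) (standardRow-covers₃ s i j))
  enteredSide-covers (a , c) (node4 s i j) with ∈-─-split (∈-allFin a) (∈-allFin i)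
  ... | inj₂ i∈rest = inj₁ (Covered-mono (inOtherRows s i∈rest) (standardRow-covers₄ s i j))
  ... | inj₁ refl with j ≟ᶠ suc c
  ...   | yes refl = inj₂ refl
  ...   | no j≢1+c = inj₁ (Covered-mono ∈-++⁺ˡ (rowMatching-covers₄ s a _ (suc c) j j≢1+c))

  perfect-covers : ∀ a b x → Covered (perfect a b) x
  perfect-covers a b x =
    [ Covered-mono (there ∘ ⊆-concatMap {f = perfectSide a b} (∈-sides (sideOf x)))
    , (λ x≡hole → subst (Covered (perfect a b)) (sym x≡hole) (hole-covered (sideOf x)))
    ]′ (enteredSide-covers (crossingEntries a b (sideOf x)) x)
    where
    hole-covered : ∀ s → let (a′ , c′) = crossingEntries a b s in
      Covered (perfect a b) (node4 s a′ (suc c′))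
    hole-covered L = node4 R b (suc a) , inj₁ (here refl)
    hole-covered R = node4 L a (suc b) , inj₂ (here refl)

  Unique-endpoints-nearPerfect : Unique (endpoints nearPerfect)
  Unique-endpoints-nearPerfect = Unique.drop⁺ 2 (covering⇒Unique n covering (≤-reflexive count))
    where
    withHoles = node2 L zero ∷ node2 R zero ∷ endpoints nearPerfect
    hole∈ : ∀ s → node2 s zero ∈ withHoles
    hole∈ L = here refl
    hole∈ R = there (here refl)
    covering : ∀ x → x ∈ withHoles
    covering x =
      [ there ∘ there ∘ Covered⇒∈endpoints
          ∘ Covered-mono (⊆-concatMap {f = nearPerfectSide} (∈-sides (sideOf x)))
      , (λ x≡hole → subst (_∈ withHoles) (sym x≡hole) (hole∈ (sideOf x)))
      ]′ (nearPerfectSide-covers x)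
    count : length withHoles ≡ numNodes n
    count = begin
      2 + length (endpoints nearPerfect) ≡⟨ cong (2 +_) (length-endpoints nearPerfect) ⟩
      2 + 2 * length nearPerfect        ≡⟨ cong (λ m → 2 + 2 * m) length-nearPerfect ⟩
      2 + 2 * (2 * sideSize n)          ≡⟨ sym (*-suc 2 (2 * sideSize n)) ⟩
      2 * suc (2 * sideSize n)          ≡⟨ sym (numNodes≡ n) ⟩
      numNodes n                        ∎

  Unique-endpoints-perfect : ∀ a b → Unique (endpoints (perfect a b))
  Unique-endpoints-perfect a b =
    covering⇒Unique n (λ x → Covered⇒∈endpoints (perfect-covers a b x)) (≤-reflexive count)
    where
    count : length (endpoints (perfect a b)) ≡ numNodes n
    count = trans (length-endpoints (perfect a b))
                  (trans (cong (2 *_) (length-perfect a b)) (sym (numNodes≡ n)))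

T-∧∧⇒≡true : ∀ {x y z} → T (x ∧ y ∧ z) → x ≡ true × y ≡ true × z ≡ true
T-∧∧⇒≡true {true} {true} {true} _ = refl , refl , refl

module _ {n : ℕ} (M : BMat n) (u v : BVec n) where

  private
    Edges : Pairs n → Set
    Edges = All (uncurry (Edge M u v))

  All⇒AllEdges : ∀ {C} → Edges C → AllEdges M u v C
  All⇒AllEdges {[]}          []       = []
  All⇒AllEdges {(_ , _) ∷ _} (e ∷ es) = e ∷ All⇒AllEdges es

  Matched⇒Edge : ∀ {C x y} → AllEdges M u v C → Matched C x y → Edge M u v x y
  Matched⇒Edge (e ∷ _)  (inj₁ (here refl)) = e
  Matched⇒Edge (e ∷ _)  (inj₂ (here refl)) = Sum.swap e
  Matched⇒Edge (_ ∷ es) (inj₁ (there p))   = Matched⇒Edge es (inj₁ p)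
  Matched⇒Edge (_ ∷ es) (inj₂ (there p))   = Matched⇒Edge es (inj₂ p)

  mainMatching-edges : ∀ s j → Edges (mainMatching s j)
  mainMatching-edges s = matchingAvoiding-All (node2 s) (node1 s) (Edge M u v)
    (λ k → inj₁ (path12 s k)) (λ k → inj₁ (path21 s k))

  rowMatching-edges : ∀ s i {entry} hole → uncurry (Edge M u v) entry → Edges (rowMatching s i entry hole)
  rowMatching-edges s i hole e = e ∷ matchingAvoiding-All (node4 s i) (node3 s i ∘ suc) (Edge M u v)
    (λ k → inj₁ (path43 s i k)) (λ k → inj₁ (path34 s i (suc k))) hole

  standardRows-edges : ∀ s is → Edges (concatMap (standardRow s) is)
  standardRows-edges s = All-concatMap (λ i → rowMatching-edges s i zero (inj₁ (path34 s i zero)))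

  nearPerfect-IsMatching : IsMatching M u v nearPerfect
  nearPerfect-IsMatching =
    All⇒AllEdges (All-concatMap side-edges sides) , Unique-endpoints-nearPerfect
    where
    side-edges : ∀ s → Edges (nearPerfectSide s)
    side-edges s = Allₚ.++⁺ (mainMatching-edges s zero) (standardRows-edges s (allFin n))

  perfect-IsMatching : ∀ {a b} → u a ≡ true → M a b ≡ true → v b ≡ true → IsMatching M u v (perfect a b)
  perfect-IsMatching {a} {b} ua mab vb =
    All⇒AllEdges (inj₁ (cross a b mab) ∷ All-concatMap side-edges sides) , Unique-endpoints-perfect a b
    where
    entry-edge : ∀ s → let (a′ , _) = crossingEntries a b s in
      Edge M u v (node2 s (suc a′)) (node3 s a′ zero)
    entry-edge L = inj₁ (uEdge a ua)
    entry-edge R = inj₁ (vEdge b vb)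
    side-edges : ∀ s → Edges (perfectSide a b s)
    side-edges s = let (a′ , c′) = crossingEntries a b s in
      Allₚ.++⁺ (rowMatching-edges s a′ (suc c′) (entry-edge s))
        (Allₚ.++⁺ (mainMatching-edges s (suc a′)) (standardRows-edges s (allFin n ─ ∈-allFin a′)))

  neighbours-node2L : ∀ {j z} → Edge M u v (node2 L j) z →
      (∃ λ a → j ≡ suc a × u a ≡ true × z ≡ node3 L a zero)
    ⊎ (∃ λ k → j ≡ inject₁ k × z ≡ node1 L k)
    ⊎ (∃ λ k → j ≡ suc k × z ≡ node1 L k)
  neighbours-node2L (inj₁ (path12 _ k)) = inj₂ (inj₁ (k , refl , refl))
  neighbours-node2L (inj₁ (uEdge a ua)) = inj₁ (a , refl , ua , refl)
  neighbours-node2L (inj₂ (path21 _ k)) = inj₂ (inj₂ (k , refl , refl))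

  neighbours-node4L : ∀ {a j z} → Edge M u v (node4 L a j) z →
      ((∃ λ b → j ≡ suc b × M a b ≡ true × z ≡ node4 R b (suc a)) ⊎ (j ≡ zero × z ≡ node3 L a zero))
    ⊎ (∃ λ k → j ≡ inject₁ k × z ≡ node3 L a (suc k))
    ⊎ (∃ λ k → j ≡ suc k × z ≡ node3 L a (suc k))
  neighbours-node4L (inj₁ (path43 _ _ k))       = inj₂ (inj₁ (k , refl , refl))
  neighbours-node4L (inj₁ (cross _ b mab))      = inj₁ (inj₁ (b , refl , mab , refl))
  neighbours-node4L (inj₂ (path34 _ _ zero))    = inj₁ (inj₂ (refl , refl))
  neighbours-node4L (inj₂ (path34 _ _ (suc k))) = inj₂ (inj₂ (k , refl , refl))

  neighbours-node3R : ∀ {b j z} → Edge M u v (node3 R b j) z →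
    v b ≡ true ⊎ z ≡ node4 R b j ⊎ (∃ λ k → j ≡ suc k × z ≡ node4 R b (inject₁ k))
  neighbours-node3R (inj₁ (path34 _ _ _)) = inj₂ (inj₁ refl)
  neighbours-node3R (inj₂ (path43 _ _ k)) = inj₂ (inj₂ (k , refl , refl))
  neighbours-node3R (inj₂ (vEdge _ vb))   = inj₁ vb

  module PerfectMatching {C : Pairs n} (edges : AllEdges M u v C) (unique : Unique (endpoints C))
    (covered : ∀ x → Covered C x) where

    open Walks (Matched C) Matched-sym (Matched-functional unique) covered

    private
      edge : ∀ {x y} → Matched C x y → Edge M u v x y
      edge = Matched⇒Edge edges

      partners-differ : ∀ {x y z} → Matched C x y → Matched C z y → x ≢ z → ⊥
      partners-differ p q x≢z = x≢z (Matched-functional unique (Matched-sym p) (Matched-sym q))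

    leavesLeftMainPath : ∃ λ a → u a ≡ true × Matched C (node2 L (suc a)) (node3 L a zero)
    leavesLeftMainPath
      with _ , _ , p , a , refl , ua , refl ←
             forwardWalk (node2 L) (node1 L) (λ { refl → refl }) (neighbours-node2L ∘ edge)
      = a , ua , p

    leavesLeftRow : ∀ {a} → Matched C (node2 L (suc a)) (node3 L a zero) →
      ∃ λ b → M a b ≡ true × Matched C (node4 L a (suc b)) (node4 R b (suc a))
    leavesLeftRow {a} entered
      with forwardWalk (node4 L a) (node3 L a ∘ suc) (λ { refl → refl }) (neighbours-node4L ∘ edge)
    ... | _ , _ , p , inj₁ (b , refl , mab , refl) = b , mab , p
    ... | _ , _ , p , inj₂ (refl , refl)           = ⊥-elim (partners-differ entered p λ ())

    reachesRightEntry : ∀ {a b} → Matched C (node4 L a (suc b)) (node4 R b (suc a)) → v b ≡ true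
    reachesRightEntry {a} {b} crossing =
      let _ , _ , _ , vb = backwardWalk (node3 R b) (node4 R b) (λ { refl → refl }) (neighbours-node3R ∘ edge)
                             (suc a) (λ p → partners-differ crossing p λ ())
      in vb

    witness : ∃₂ λ a b → u a ≡ true × M a b ≡ true × v b ≡ true
    witness =
      let a , ua , entered = leavesLeftMainPath
          b , mab , crossing = leavesLeftRow entered
      in a , b , ua , mab , reachesRightEntry crossing

  IsMatching⇒length≤ : ∀ {C} → IsMatching M u v C → length C ≤ suc (2 * sideSize n)
  IsMatching⇒length≤ {C} (_ , unique) =
    *-cancelˡ-≤ 2 (subst₂ _≤_ (length-endpoints C) (numNodes≡ n) (Unique⇒length≤numNodes n unique))

  perfectSize⇒witness : ∀ {C} → IsMatching M u v C → length C ≡ suc (2 * sideSize n) →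
    ∃₂ λ a b → u a ≡ true × M a b ≡ true × v b ≡ true
  perfectSize⇒witness {C} (edges , unique) ∣C∣≡ =
    PerfectMatching.witness edges unique
      (∈endpoints⇒Covered ∘ Unique⇒covering n unique (≤-reflexive count))
    where
    count : numNodes n ≡ length (endpoints C)
    count = trans (numNodes≡ n) (sym (trans (length-endpoints C) (cong (2 *_) ∣C∣≡)))

  bprod≡true⇒witness : bprod u M v ≡ true → ∃₂ λ a b → u a ≡ true × M a b ≡ true × v b ≡ true
  bprod≡true⇒witness uMv
    with a , t  ← satisfied (any⁻ _ (allFin n) (Equivalence.from T-≡ uMv))
    with b , t′ ← satisfied (any⁻ _ (allFin n) t)
    = a , b , T-∧∧⇒≡true t′

  witness⇒bprod≡true : ∀ {a b} → u a ≡ true → M a b ≡ true → v b ≡ true → bprod u M v ≡ true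
  witness⇒bprod≡true {a} {b} ua mab vb =
    Equivalence.to T-≡ (any⁺ _ (lose (∈-allFin a) (any⁺ _ (lose (∈-allFin b) uMv))))
    where
    uMv : T (u a ∧ M a b ∧ v b)
    uMv rewrite ua | mab | vb = _

lemma10 : (n : ℕ) → 1 ≤ n → (M : BMat n) → (u v : BVec n) →
    ∀ C → IsMaximumMatching M u v C →
    (bprod u M v ≡ true → length C ≡ numNodes n / 2) ×
    (bprod u M v ≡ false → length C ≡ numNodes n / 2 ∸ 1)
lemma10 n _ M u v C (isMatching , maximum) = perfectCase , nearPerfectCase
  where
  ∣C∣≤ : length C ≤ suc (2 * sideSize n)
  ∣C∣≤ = IsMatching⇒length≤ M u v isMatching

  perfectCase : bprod u M v ≡ true → length C ≡ numNodes n / 2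
  perfectCase uMv =
    let a , b , ua , mab , vb = bprod≡true⇒witness M u v uMv
        ∣C∣≥ = maximum (perfect a b) (perfect-IsMatching M u v ua mab vb)
    in trans (≤-antisym ∣C∣≤ (subst (_≤ length C) (length-perfect a b) ∣C∣≥)) (sym (numNodes/2 n))

  nearPerfectCase : bprod u M v ≡ false → length C ≡ numNodes n / 2 ∸ 1
  nearPerfectCase ¬uMv = subst (λ m → length C ≡ m ∸ 1) (sym (numNodes/2 n))
    (≤-antisym (s≤s⁻¹ (≤∧≢⇒< ∣C∣≤ notPerfect)) ∣C∣≥)
    where
    ∣C∣≥ : 2 * sideSize n ≤ length C
    ∣C∣≥ = subst (_≤ length C) (length-nearPerfect {n})
             (maximum (nearPerfect {n}) (nearPerfect-IsMatching M u v))
    notPerfect : length C ≢ suc (2 * sideSize n)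
    notPerfect ∣C∣≡ = let _ , _ , ua , mab , vb = perfectSize⇒witness M u v isMatching ∣C∣≡ in
      contradiction (trans (sym (witness⇒bprod≡true M u v ua mab vb)) ¬uMv) λ ()
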